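{- Let $a,b$ be integers satisfying one of the following: (2a) $a \equiv b \equiv 1 \pmod 3$; (2b) $a \equiv 2 \pmod 3$ and $b \equiv 0 \pmod 3$; (2c) $a \equiv 1 \pmod 3$ and $b \equiv 0 \pmod 3$. Let $T_2 = \{\alpha \in LQ_{a,b} \mid 2 \nmid \alpha_0,\ 3 \nmid \alpha_1\alpha_3,\ 3 \mid \alpha_2\}$, $T_3 = \{\alpha \in LQ_{a,b} \mid 2 \nmid \alpha_0,\ 3 \nmid \alpha_1\alpha_2,\ 3 \mid \alpha_3\}$, and $T = T_2 \cup T_3$, where $\alpha = \alpha_0 + \alpha_1\mathbf{i} + \alpha_2\mathbf{j} + \alpha_3\mathbf{k}$. Then for every $\alpha \in LQ_{a,b}$ there exist $\alpha', \alpha'' \in T$ such that $\mathrm{Re}(\alpha' + \alpha'') \equiv \mathrm{Re}(\alpha) \pmod 3$ and $\mathrm{Im}(\alpha' + \alpha'') \equiv \mathrm{Im}(\alpha) \pmod 6$.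
   Context: For integers $a,b$, $LQ_{a,b}$ denotes the quaternion ring $\{\alpha_0 + \alpha_1 \mathbf{i} + \alpha_2 \mathbf{j} + \alpha_3 \mathbf{k} \mid \alpha_n \in \mathbb{Z}\}$ with multiplication determined by $\mathbf{i}^2 = -a$, $\mathbf{j}^2 = -b$, $\mathbf{i}\mathbf{j} = -\mathbf{j}\mathbf{i} = \mathbf{k}$. For $x = x_0 + x_1\mathbf{i} + x_2\mathbf{j} + x_3\mathbf{k}$, $\mathrm{Re}(x) = x_0$ and $\mathrm{Im}(x) = x_1\mathbf{i} + x_2\mathbf{j} + x_3\mathbf{k}$. We write $\mathrm{Im}(x) \equiv \mathrm{Im}(y) \pmod 6$ if $6$ divides each of the coefficients of $\mathrm{Im}(x-y)$. -}

module Defs where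

open import Data.Integer using (ℤ; +_; _+_; _-_; _*_; -_)
open import Data.Integer.Divisibility using (_∣_)
open import Data.Product using (_×_)
open import Data.Sum using (_⊎_)
open import Relation.Nullary using (¬_)

-- Elements of LQ_{a,b}: α₀ + α₁ i + α₂ j + α₃ k with integer coefficients.
-- The parameters a b fix the ring (i² = -a, j² = -b, ij = -ji = k).
record LQ (a b : ℤ) : Set where
  constructor quat
  field
    c0 c1 c2 c3 : ℤ
open LQ public

module _ {a b : ℤ} where
  _+Q_ : LQ a b → LQ a b → LQ a b
  quat x0 x1 x2 x3 +Q quat y0 y1 y2 y3 = quat (x0 + y0) (x1 + y1) (x2 + y2) (x3 + y3)

  -- Multiplication in LQ_{a,b} (k² = -ab, ik = -a j, ki = a j, jk = b i, kj = -b i); not needed by the statement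
  _*Q_ : LQ a b → LQ a b → LQ a b
  quat x0 x1 x2 x3 *Q quat y0 y1 y2 y3 =
    quat (x0 * y0 - a * x1 * y1 - b * x2 * y2 - a * b * x3 * y3)
         (x0 * y1 + x1 * y0 + b * x2 * y3 - b * x3 * y2)
         (x0 * y2 + x2 * y0 - a * x1 * y3 + a * x3 * y1)
         (x0 * y3 + x3 * y0 + x1 * y2 - x2 * y1)

  Re : LQ a b → ℤ
  Re = c0

infix 4 _≡[_]_
_≡[_]_ : ℤ → ℤ → ℤ → Set
x ≡[ n ] y = n ∣ (x - y)

module _ {a b : ℤ} where
  ImCong6 : LQ a b → LQ a b → Set
  ImCong6 x y = (c1 x ≡[ + 6 ] c1 y) × (c2 x ≡[ + 6 ] c2 y) × (c3 x ≡[ + 6 ] c3 y)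

  T₂ : LQ a b → Set
  T₂ α = ¬ (+ 2 ∣ c0 α) × ¬ (+ 3 ∣ (c1 α * c3 α)) × (+ 3 ∣ c2 α)

  T₃ : LQ a b → Set
  T₃ α = ¬ (+ 2 ∣ c0 α) × ¬ (+ 3 ∣ (c1 α * c2 α)) × (+ 3 ∣ c3 α)

  T : LQ a b → Set
  T α = T₂ α ⊎ T₃ α

Cond2 : ℤ → ℤ → Set
Cond2 a b = ((a ≡[ + 3 ] + 1) × (b ≡[ + 3 ] + 1))
          ⊎ ((a ≡[ + 3 ] + 2) × (b ≡[ + 3 ] + 0))
          ⊎ ((a ≡[ + 3 ] + 1) × (b ≡[ + 3 ] + 0))

module Submission where

-- Only the additive structure of LQ_{a,b} enters the statement, so the
-- proof is a decomposition of the coefficients of α, valid for every a, b.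
--
-- Real part: 1 + (4α₀ - 1) ≡ α₀ (mod 3) and both summands are odd.
-- Imaginary part: we take α″ := the partner of α′, whose imaginary
-- coefficients are exactly Im(α) - Im(α′), so Im(α′ + α″) = Im(α) and the
-- congruence mod 6 is an identity.  It remains to choose Im(α′) so that
-- both α′ and α″ lie in T.  Every integer is the sum of two integers prime
-- to 3 (take 1 or 2 as the first summand), and a product of two integers
-- prime to the prime 3 is prime to 3.  So we split α₁ this way, and:
--   * if 3 ∣ α₂, split α₃ as well: α′, α″ ∈ T₂ (coefficient j of α′ is 0);
--   * if 3 ∣ α₃, split α₂ as well: α′, α″ ∈ T₃ (coefficient k of α′ is 0);
--   * otherwise α′ = 1 + c i + α₃ k ∈ T₂ and α″ = … + α₂ j ∈ T₃.

open import Defs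
open import Data.Integer using (ℤ; +_; _+_; _-_; _*_; ∣_∣)
open import Data.Integer.Divisibility using (_∣_; divides)
import Data.Integer.Divisibility.Signed as Signed
open import Data.Integer.Properties using (abs-*; +-identityʳ; +-inverseʳ)
open import Data.Integer.Tactic.RingSolver using (solve-∀)
open import Data.Nat.Base using (ℕ)
import Data.Nat.Divisibility as ℕ
open import Data.Nat.Primality using (Prime; prime?; euclidsLemma)
open import Data.Product using (Σ; _×_; _,_)
open import Data.Sum using (inj₁; inj₂)
open import Relation.Nullary using (¬_; Dec; yes; no)
open import Relation.Nullary.Decidable using (toWitness)
open import Relation.Binary.PropositionalEquality using (_≡_; refl; sym; subst)

∣-sub : ∀ {k} m n → k ∣ m → k ∣ n → k ∣ (m - n)
∣-sub {k} m n k∣m k∣n =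
  Signed.∣⇒∣ᵤ {k} {m - n} (Signed.∣m∣n⇒∣m-n (Signed.∣ᵤ⇒∣ {k} {m} k∣m) (Signed.∣ᵤ⇒∣ {k} {n} k∣n))

∣-*ʳ : ∀ {k m} n → k ∣ m → k ∣ (m * n)
∣-*ʳ {k} {m} n k∣m = Signed.∣⇒∣ᵤ {k} {m * n} (Signed.∣m⇒∣m*n n (Signed.∣ᵤ⇒∣ {k} {m} k∣m))

≡⇒≡[] : ∀ n {x y} → x ≡ y → x ≡[ n ] y
≡⇒≡[] n {x} refl = subst (n ∣_) (sym (+-inverseʳ x)) (divides 0 refl)

-- Subtracting 0 changes neither divisibility nor non-divisibility (needed
-- because the partner's coefficient is x - 0 when α′ has coefficient 0).
∣-0 : ∀ {k} x → k ∣ x → k ∣ (x - + 0)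
∣-0 {k} x = subst (k ∣_) (sym (+-identityʳ x))

∤-0 : ∀ {k} x → ¬ (k ∣ x) → ¬ (k ∣ (x - + 0))
∤-0 {k} x k∤x k∣x-0 = k∤x (subst (k ∣_) (+-identityʳ x) k∣x-0)

∣? : ∀ (k : ℕ) x → Dec (+ k ∣ x)
∣? k x = k ℕ.∣? ∣ x ∣

prime-∤-* : ∀ {p} → Prime p → ∀ u v → ¬ (+ p ∣ u) → ¬ (+ p ∣ v) → ¬ (+ p ∣ (u * v))
prime-∤-* {p} p-prime u v p∤u p∤v p∣uv
  with euclidsLemma ∣ u ∣ ∣ v ∣ p-prime (subst (p ℕ.∣_) (abs-* u v) p∣uv)
... | inj₁ p∣u = p∤u p∣u
... | inj₂ p∣v = p∤v p∣v

3-prime : Prime 3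
3-prime = toWitness {a? = prime? 3} _

3∤1 : ¬ (+ 3 ∣ + 1)
3∤1 (divides ℕ.zero ())
3∤1 (divides (ℕ.suc _) ())

3∤2 : ¬ (+ 3 ∣ + 2)
3∤2 (divides ℕ.zero ())
3∤2 (divides (ℕ.suc _) ())

2∤1 : ¬ (+ 2 ∣ + 1)
2∤1 (divides ℕ.zero ())
2∤1 (divides (ℕ.suc _) ())

-- Every integer is a sum c + (x - c) of two integers not divisible by d,
-- provided d divides neither 1 nor 2: since (x - 1) - (x - 2) = 1, at least
-- one of c = 1, c = 2 works.
nonMultipleSplit : ∀ (d : ℕ) → ¬ (+ d ∣ + 1) → ¬ (+ d ∣ + 2) →
  ∀ x → Σ ℤ λ c → ¬ (+ d ∣ c) × ¬ (+ d ∣ (x - c))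
nonMultipleSplit d d∤1 d∤2 x with ∣? d (x - + 1)
... | no  d∤x-1 = + 1 , d∤1 , d∤x-1
... | yes d∣x-1 = + 2 , d∤2 , λ d∣x-2 →
  d∤1 (subst (+ d ∣_) (difference x) (∣-sub {+ d} (x - + 1) (x - + 2) d∣x-1 d∣x-2))
  where
  difference : ∀ x → (x - + 1) - (x - + 2) ≡ + 1
  difference = solve-∀

3-split : ∀ x → Σ ℤ λ c → ¬ (+ 3 ∣ c) × ¬ (+ 3 ∣ (x - c))
3-split = nonMultipleSplit 3 3∤1 3∤2

odd-4x-1 : ∀ x → ¬ (+ 2 ∣ (+ 4 * x - + 1))
odd-4x-1 x 2∣4x-1 =
  2∤1 (subst (+ 2 ∣_) (difference x) (∣-sub {+ 2} (+ 4 * x) (+ 4 * x - + 1) (∣-*ʳ {+ 2} {+ 4} x (divides 2 refl)) 2∣4x-1))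
  where
  difference : ∀ x → + 4 * x - (+ 4 * x - + 1) ≡ + 1
  difference = solve-∀

1+[4x-1]≡x : ∀ x → (+ 1 + (+ 4 * x - + 1)) ≡[ + 3 ] x
1+[4x-1]≡x x = subst (+ 3 ∣_) (sym (difference x)) (∣-*ʳ {+ 3} {+ 3} x (divides 1 refl))
  where
  difference : ∀ x → (+ 1 + (+ 4 * x - + 1)) - x ≡ + 3 * x
  difference = solve-∀

split-≡ : ∀ n x c → (c + (x - c)) ≡[ n ] x
split-≡ n x c = ≡⇒≡[] n (telescope x c)
  where
  telescope : ∀ x c → c + (x - c) ≡ x
  telescope = solve-∀

module _ {a b : ℤ} (α : LQ a b) where

  unitReal : ℤ → ℤ → ℤ → LQ a b
  unitReal y₁ y₂ y₃ = quat (+ 1) y₁ y₂ y₃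

  partner : ℤ → ℤ → ℤ → LQ a b
  partner y₁ y₂ y₃ = quat (+ 4 * c0 α - + 1) (c1 α - y₁) (c2 α - y₂) (c3 α - y₃)

  partner-sum : ∀ y₁ y₂ y₃ →
    (Re (unitReal y₁ y₂ y₃ +Q partner y₁ y₂ y₃) ≡[ + 3 ] Re α)
    × ImCong6 (unitReal y₁ y₂ y₃ +Q partner y₁ y₂ y₃) α
  partner-sum y₁ y₂ y₃ =
    1+[4x-1]≡x (c0 α) , split-≡ (+ 6) (c1 α) y₁ , split-≡ (+ 6) (c2 α) y₂ , split-≡ (+ 6) (c3 α) y₃

  fromPartners : ∀ y₁ y₂ y₃ → T (unitReal y₁ y₂ y₃) → T (partner y₁ y₂ y₃) →
    Σ (LQ a b) λ α′ → Σ (LQ a b) λ α″ →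
      T α′ × T α″ × (Re (α′ +Q α″) ≡[ + 3 ] Re α) × ImCong6 (α′ +Q α″) α
  fromPartners y₁ y₂ y₃ α′∈T α″∈T = unitReal y₁ y₂ y₃ , partner y₁ y₂ y₃ , α′∈T , α″∈T , partner-sum y₁ y₂ y₃

mainTheorem7 : (a b : ℤ) → Cond2 a b → (α : LQ a b) →
    Σ (LQ a b) λ α′ → Σ (LQ a b) λ α″ →
    T α′ × T α″ × (Re (α′ +Q α″) ≡[ + 3 ] Re α) × ImCong6 (α′ +Q α″) α
mainTheorem7 a b _ α@(quat x₀ x₁ x₂ x₃) with 3-split x₁ | ∣? 3 x₂ | ∣? 3 x₃
... | c₁ , 3∤c₁ , 3∤x₁-c₁ | yes 3∣x₂ | _ with 3-split x₃
...   | c₃ , 3∤c₃ , 3∤x₃-c₃ = fromPartners α c₁ (+ 0) c₃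
  (inj₁ (2∤1 , prime-∤-* 3-prime c₁ c₃ 3∤c₁ 3∤c₃ , divides 0 refl))
  (inj₁ (odd-4x-1 x₀ , prime-∤-* 3-prime (x₁ - c₁) (x₃ - c₃) 3∤x₁-c₁ 3∤x₃-c₃ , ∣-0 {+ 3} x₂ 3∣x₂))
mainTheorem7 a b _ α@(quat x₀ x₁ x₂ x₃) | c₁ , 3∤c₁ , 3∤x₁-c₁ | no _ | yes 3∣x₃ with 3-split x₂
...   | c₂ , 3∤c₂ , 3∤x₂-c₂ = fromPartners α c₁ c₂ (+ 0)
  (inj₂ (2∤1 , prime-∤-* 3-prime c₁ c₂ 3∤c₁ 3∤c₂ , divides 0 refl))
  (inj₂ (odd-4x-1 x₀ , prime-∤-* 3-prime (x₁ - c₁) (x₂ - c₂) 3∤x₁-c₁ 3∤x₂-c₂ , ∣-0 {+ 3} x₃ 3∣x₃))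
mainTheorem7 a b _ α@(quat x₀ x₁ x₂ x₃) | c₁ , 3∤c₁ , 3∤x₁-c₁ | no 3∤x₂ | no 3∤x₃ =
  fromPartners α c₁ (+ 0) x₃
  (inj₁ (2∤1 , prime-∤-* 3-prime c₁ x₃ 3∤c₁ 3∤x₃ , divides 0 refl))
  (inj₂ (odd-4x-1 x₀ , prime-∤-* 3-prime (x₁ - c₁) (x₂ - + 0) 3∤x₁-c₁ (∤-0 {+ 3} x₂ 3∤x₂) , ≡⇒≡[] (+ 3) {x₃} refl))
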